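{- Let $D=\{0,1,2\}$ and let $g$ be a binary predicate on $D$ such that, for some $a\in D$, $g(x,a)=1$ for all $x\in D$. Define the binary predicate $g'$ by $g'(x,y)=0$ if $y=a$ and $g'(x,y)=g(x,y)$ otherwise. Then: (1) for every chain on $D$, $g$ is supermodular on it if and only if $g'$ is supermodular on it; and (2) $\{g,u_{D\setminus\{a\}}\}$ strictly implements $g'$.
   Context: A binary predicate on $D$ is a function $D^2\to\{0,1\}$ (values treated as integers). For $\emptyset\ne S\subseteq D$, $u_S$ is the unary predicate with $u_S(x)=1$ iff $x\in S$. A chain on $D$ is a total order on $D$; an $n$-ary predicate $f$ is supermodular on it if $f(\mathbf{a})+f(\mathbf{b})\le f(\min(\mathbf{a},\mathbf{b}))+f(\max(\mathbf{a},\mathbf{b}))$ for all $\mathbf{a},\mathbf{b}\in D^n$ (componentwise $\min,\max$ in the chain). A set $\mathcal{F}$ of predicates strictly implements an $m$-ary predicate $h$ if there exist $\alpha\in\mathbb{Z}_{\ge0}$, disjoint sets of variables $Y=\{y_1,\dots,y_m\}$ and $Z$ (possibly empty), and constraints $g_1(\mathbf{y}_1),\dots,g_s(\mathbf{y}_s)$, $s>0$, with $g_i\in\mathcal{F}$ and scopes $\mathbf{y}_i$ tuples of variables from $Y\cup Z$, such that for all $y_1,\dots,y_m\in D$: $h(y_1,\dots,y_m)+(\alpha-1)=\max_Z\sum_{i=1}^s g_i(\mathbf{y}_i)$, the maximum over all assignments to $Z$. -}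

module Defs where

open import Level using (0ℓ)
open import Data.Nat using (ℕ; zero; suc; _+_; _≤_)
open import Data.Fin using (Fin; zero; suc; _≟_)
open import Data.Unit using (⊤)
open import Data.Empty using (⊥)
open import Data.Bool using (Bool; true; false)
open import Data.Sum using (_⊎_; inj₁; inj₂)
open import Data.Product using (Σ; ∃; _×_; _,_)
open import Data.List using (List; []; _∷_; foldr; map)
open import Data.List.Membership.Propositional using (_∈_)
open import Relation.Binary.Core using (Rel)
open import Relation.Binary.Structures using (IsDecTotalOrder)
open import Relation.Binary.PropositionalEquality using (_≡_)
open import Relation.Nullary using (yes; no; ¬_)

D : Set
D = Fin 3

val : Bool → ℕ
val false = 0
val true  = 1

Pred : ℕ → Set
Pred n = (Fin n → D) → Bool

BinPred : Set
BinPred = D → D → Bool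

asPred2 : BinPred → Pred 2
asPred2 g t = g (t zero) (t (suc zero))

u : (D → Bool) → Pred 1
u S t = S (t zero)

-- A chain on D: a (decidable) total order on D.
record Chain : Set₁ where
  field
    _≼_ : Rel D 0ℓ
    isDecTotalOrder : IsDecTotalOrder _≡_ _≼_
  open IsDecTotalOrder isDecTotalOrder public using (_≤?_)

  cmin : D → D → D
  cmin x y with x ≤? y
  ... | yes _ = x
  ... | no  _ = y

  cmax : D → D → D
  cmax x y with x ≤? y
  ... | yes _ = y
  ... | no  _ = x

Supermodular : (C : Chain) → {n : ℕ} → Pred n → Set
Supermodular C {n} f =
  (a b : Fin n → D) →
  val (f a) + val (f b) ≤ val (f (λ i → cmin (a i) (b i))) + val (f (λ i → cmax (a i) (b i)))
  where open Chain C

APred : Set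
APred = Σ ℕ Pred

-- A constraint over variables Y = Fin m and Z = Fin k (disjoint union):
-- a predicate g (with its arity r) from the set F, and a scope tuple of variables.
record Constraint (F : List APred) (m k : ℕ) : Set where
  constructor constraint
  field
    arity : ℕ
    pred  : Pred arity
    inF   : (arity , pred) ∈ F
    scope : Fin arity → Fin m ⊎ Fin k

assign : {m k : ℕ} → (Fin m → D) → (Fin k → D) → Fin m ⊎ Fin k → D
assign y z (inj₁ i) = y i
assign y z (inj₂ j) = z j

evalC : {F : List APred} {m k : ℕ} → Constraint F m k → (Fin m → D) → (Fin k → D) → ℕ
evalC (constraint r g _ sc) y z = val (g (λ i → assign y z (sc i)))

evalCs : {F : List APred} {m k : ℕ} → List (Constraint F m k) → (Fin m → D) → (Fin k → D) → ℕ
evalCs []       y z = 0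
evalCs (c ∷ cs) y z = evalC c y z + evalCs cs y z

NonEmpty : {A : Set} → List A → Set
NonEmpty [] = ⊥
NonEmpty (_ ∷ _) = ⊤

-- F strictly implements the m-ary predicate h:
-- there are α ∈ ℕ, k auxiliary variables Z, and a nonempty list of constraints
-- such that for all y, h(y) + (α - 1) = max_z Σ_i g_i.
-- Since α - 1 may be -1, this is stated (equivalently, over ℤ) as
-- max_z (Σ_i g_i) + 1 = h(y) + α: every z gives Σ + 1 ≤ h(y) + α and some z attains equality.
StrictlyImplements : (F : List APred) → {m : ℕ} → Pred m → Set
StrictlyImplements F {m} h =
  Σ ℕ λ α → Σ ℕ λ k → Σ (List (Constraint F m k)) λ cs →
    NonEmpty cs ×
    ((y : Fin m → D) →
       ((z : Fin k → D) → evalCs cs y z + 1 ≤ val (h y) + α) ×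
       (∃ λ (z : Fin k → D) → evalCs cs y z + 1 ≡ val (h y) + α))

g′ : BinPred → D → BinPred
g′ g a x y with y ≟ a
... | yes _ = false
... | no  _ = g x y

notA : D → D → Bool
notA a x with x ≟ a
... | yes _ = false
... | no  _ = true

{-# OPTIONS --safe #-}
-- Pointwise g = g′ + [y = a], and a function depending on one
-- coordinate only is modular on every chain, since {min(x,y), max(x,y)} = {x,y};
-- adding a modular function to a predicate does not change supermodularity.
-- Equivalently g(x,y) + u(y) = g′(x,y) + 1 with u = u_{D∖{a}}, which is a
-- strict implementation with α = 2 and no auxiliary variables.
module Submission where

open import Defs
open import Data.Bool using (true)
open import Data.Product using (_×_; _,_)
open import Data.List using (List; _∷_; [])
open import Data.List.Relation.Unary.Any using (here; there)
open import Data.Nat using (ℕ; zero; suc; _+_; _≤_)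
open import Data.Nat.Properties
  using (+-comm; +-assoc; +-identityʳ; +-cancelʳ-≤; +-monoˡ-≤; ≤-reflexive; +-commutativeSemigroup)
open import Algebra.Properties.CommutativeSemigroup +-commutativeSemigroup using (interchange)
open import Data.Fin using (Fin; zero; suc; _≟_)
open import Data.Sum using (inj₁)
open import Relation.Binary.PropositionalEquality using (_≡_; refl; sym; cong; module ≡-Reasoning)
open import Relation.Nullary using (yes; no; does)
open import Function.Bundles using (_⇔_; mk⇔; module Equivalence)

+-≤-cancel-⇔ : ∀ p q r s {i j k l} → i + j ≡ k + l →
  (p + i) + (q + j) ≤ (r + k) + (s + l) ⇔ p + q ≤ r + s
+-≤-cancel-⇔ p q r s {i} {j} {k} {l} i+j≡k+l = mk⇔ cancel shift
  where
  cancel : (p + i) + (q + j) ≤ (r + k) + (s + l) → p + q ≤ r + s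
  cancel le rewrite interchange p i q j | interchange r k s l | i+j≡k+l =
    +-cancelʳ-≤ (k + l) (p + q) (r + s) le
  shift : p + q ≤ r + s → (p + i) + (q + j) ≤ (r + k) + (s + l)
  shift le rewrite interchange p i q j | interchange r k s l | i+j≡k+l =
    +-monoˡ-≤ (k + l) le

module _ (C : Chain) where
  open Chain C

  _⊓̇_ _⊔̇_ : {n : ℕ} → (Fin n → D) → (Fin n → D) → Fin n → D
  (s ⊓̇ t) i = cmin (s i) (t i)
  (s ⊔̇ t) i = cmax (s i) (t i)

  Modular : {n : ℕ} → ((Fin n → D) → ℕ) → Set
  Modular {n} μ = (s t : Fin n → D) → μ s + μ t ≡ μ (s ⊓̇ t) + μ (s ⊔̇ t)

  cmin+cmax : (φ : D → ℕ) (x y : D) → φ x + φ y ≡ φ (cmin x y) + φ (cmax x y)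
  cmin+cmax φ x y with x ≤? y
  ... | yes _ = refl
  ... | no  _ = +-comm (φ x) (φ y)

  modular-coordinate : {n : ℕ} (φ : D → ℕ) (i : Fin n) → Modular (λ t → φ (t i))
  modular-coordinate φ i s t = cmin+cmax φ (s i) (t i)

  supermodular-⇔-modular-shift : {n : ℕ} {f f′ : Pred n} (μ : (Fin n → D) → ℕ) →
    Modular μ → (∀ t → val (f t) ≡ val (f′ t) + μ t) →
    Supermodular C f ⇔ Supermodular C f′
  supermodular-⇔-modular-shift {f = f} {f′} μ μ-modular f≡f′+μ =
    mk⇔ (λ sm s t → Equivalence.to (shifted s t) (sm s t))
        (λ sm s t → Equivalence.from (shifted s t) (sm s t))
    where
    shifted : ∀ s t →
      val (f s) + val (f t) ≤ val (f (s ⊓̇ t)) + val (f (s ⊔̇ t)) ⇔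
      val (f′ s) + val (f′ t) ≤ val (f′ (s ⊓̇ t)) + val (f′ (s ⊔̇ t))
    shifted s t rewrite f≡f′+μ s | f≡f′+μ t | f≡f′+μ (s ⊓̇ t) | f≡f′+μ (s ⊔̇ t) =
      +-≤-cancel-⇔ (val (f′ s)) (val (f′ t)) (val (f′ (s ⊓̇ t))) (val (f′ (s ⊔̇ t)))
        (μ-modular s t)

strictlyImplements-without-auxiliary : {F : List APred} {m : ℕ} {h : Pred m}
  (α : ℕ) (cs : List (Constraint F m 0)) → NonEmpty cs →
  (∀ y z → evalCs cs y z + 1 ≡ val (h y) + α) → StrictlyImplements F h
strictlyImplements-without-auxiliary α cs cs≢[] exact =
  α , 0 , cs , cs≢[] , λ y → (λ z → ≤-reflexive (exact y z)) , ((λ ()) , exact y (λ ()))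

module _ (g : BinPred) (a : D) (ga≡1 : ∀ x → g x a ≡ true) where

  g≡g′+[≡a] : ∀ x y → val (g x y) ≡ val (g′ g a x y) + val (does (y ≟ a))
  g≡g′+[≡a] x y with y ≟ a
  ... | yes refl rewrite ga≡1 x = refl
  ... | no  _   = sym (+-identityʳ _)

  g+u≡g′+1 : ∀ x y → val (g x y) + val (notA a y) ≡ val (g′ g a x y) + 1
  g+u≡g′+1 x y with y ≟ a
  ... | yes refl rewrite ga≡1 x = refl
  ... | no  _   = refl

lemma3p3 : (g : BinPred) (a : D) → (∀ x → g x a ≡ true) →
    ((C : Chain) → Supermodular C (asPred2 g) ⇔ Supermodular C (asPred2 (g′ g a)))
    × StrictlyImplements ((2 , asPred2 g) ∷ (1 , u (notA a)) ∷ []) (asPred2 (g′ g a))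
lemma3p3 g a ga≡1 = supermodular , implementation
  where
  y₁ y₂ : Fin 2
  y₁ = zero
  y₂ = suc zero

  supermodular : (C : Chain) → Supermodular C (asPred2 g) ⇔ Supermodular C (asPred2 (g′ g a))
  supermodular C = supermodular-⇔-modular-shift C (λ t → val (does (t y₂ ≟ a)))
    (modular-coordinate C (λ y → val (does (y ≟ a))) y₂)
    (λ t → g≡g′+[≡a] g a ga≡1 (t y₁) (t y₂))

  implementation : StrictlyImplements ((2 , asPred2 g) ∷ (1 , u (notA a)) ∷ []) (asPred2 (g′ g a))
  implementation = strictlyImplements-without-auxiliary 2
    (constraint 2 (asPred2 g) (here refl) (λ i → inj₁ i)
      ∷ constraint 1 (u (notA a)) (there (here refl)) (λ _ → inj₁ y₂) ∷ [])
    _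
    (λ y _ → constraints-sum (y y₁) (y y₂))
    where
    open ≡-Reasoning
    constraints-sum : ∀ x y →
      val (g x y) + (val (notA a y) + 0) + 1 ≡ val (g′ g a x y) + 2
    constraints-sum x y = begin
      val (g x y) + (val (notA a y) + 0) + 1 ≡⟨ cong (λ n → val (g x y) + n + 1) (+-identityʳ _) ⟩
      val (g x y) + val (notA a y) + 1       ≡⟨ cong (_+ 1) (g+u≡g′+1 g a ga≡1 x y) ⟩
      val (g′ g a x y) + 1 + 1               ≡⟨ +-assoc (val (g′ g a x y)) 1 1 ⟩
      val (g′ g a x y) + 2                   ∎
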